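{- Let $m\ge 1$, let $c$ be a positive divisor of $2m-1$ and $d=\frac{2m-1}{c}$. Take the vertex set of $K_{2m}$ to be $\{v_\infty\}\cup\{v_{i,j}: i\in[c],\ j\in[d]\}$, with $v_{i,j}=v_{i',j'}$ whenever $i\equiv i'\pmod c$ and $j\equiv j'\pmod d$. For an integer $x$ and odd positive integer $y$ let $P_{x,y}=\bigl\{\{x+l,x-l\}: l\in[\tfrac{y+1}{2}]\bigr\}$, entries taken modulo $y$ (so $l=0$ gives the singleton $\{x\}$). For $i\in[c]$, $j\in[d]$ let $M_{i,j}$ be the subgraph with edge set \[ \bigl\{\{v_\infty,v_{i,j}\}\bigr\}\cup\bigl\{\{v_{a_1,b_1},v_{a_2,b_2}\}: \{a_1,a_2\}\in P_{i,c},\ \{b_1,b_2\}\in P_{j,d},\ a_1\ne i \text{ or } b_1\ne j\bigr\}. \] Then $\{M_{i,j}: i\in[c], j\in[d]\}$ is a matching decomposition of $K_{2m}$, i.e. each $M_{i,j}$ is a matching and every edge of $K_{2m}$ lies in exactly one $M_{i,j}$.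
   Context: For an integer $N$, $[N]=\{0,1,\dots,N-1\}$. A matching is a subgraph in which every vertex of it has degree 1 (a set of pairwise disjoint edges). -}

module Defs where

open import Data.Nat using (ℕ; _+_; _∸_; _<_; _/_; _%_; NonZero)
open import Data.Fin using (Fin; toℕ)
open import Data.Product using (Σ; ∃; _×_; _,_)
open import Data.Sum using (_⊎_)
open import Relation.Binary.PropositionalEquality using (_≡_; _≢_)
open import Relation.Nullary using (¬_)

-- Indices are residues (Fin c, Fin d), which builds in v_{i,j} = v_{i',j'}
-- whenever i ≡ i' (mod c) and j ≡ j' (mod d).
data Vertex (c d : ℕ) : Set where
  v∞ : Vertex c d
  v  : Fin c → Fin d → Vertex c d

-- Residue of x - l mod y is computed as (x + (y ∸ l)) % y, valid since l ≤ y.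
InP : (y : ℕ) .{{_ : NonZero y}} → Fin y → Fin y → Fin y → Set
InP y x a₁ a₂ = ∃ λ l → l < (y + 1) / 2 ×
  ( (toℕ a₁ ≡ (toℕ x + l) % y × toℕ a₂ ≡ (toℕ x + (y ∸ l)) % y)
  ⊎ (toℕ a₁ ≡ (toℕ x + (y ∸ l)) % y × toℕ a₂ ≡ (toℕ x + l) % y) )

MEdge : (c d : ℕ) .{{_ : NonZero c}} .{{_ : NonZero d}} →
        Fin c → Fin d → Vertex c d → Vertex c d → Set
MEdge c d i j u w =
    (u ≡ v∞ × w ≡ v i j)
  ⊎ (u ≡ v i j × w ≡ v∞)
  ⊎ (Σ (Fin c) λ a₁ → Σ (Fin c) λ a₂ → Σ (Fin d) λ b₁ → Σ (Fin d) λ b₂ →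
       InP c i a₁ a₂ × InP d j b₁ b₂ × (a₁ ≢ i ⊎ b₁ ≢ j) ×
       ((u ≡ v a₁ b₁ × w ≡ v a₂ b₂) ⊎ (u ≡ v a₂ b₂ × w ≡ v a₁ b₁)))

IsMatching : {V : Set} → (V → V → Set) → Set
IsMatching {V} E = (∀ u → ¬ E u u) × (∀ u w w′ → E u w → E u w′ → w ≡ w′)

-- For odd y, the pairs {x + l, x − l} with l ∈ [(y+1)/2] are exactly the pairs
-- {a₁, a₂} of residues with a₁ + a₂ ≡ 2x (mod y), and since 2 is invertible modulo y
-- every pair has exactly one such midpoint x. As c and d divide the odd number 2m − 1,
-- both are odd, so M_{i,j} joins v_{a₁,b₁} to its reflection v_{2i−a₁,2j−b₁} in the
-- point (i, j) of ℤ_c × ℤ_d, and its fixed point v_{i,j} to v_∞. Hence each M_{i,j} is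
-- a matching, an edge {v_∞, v_{a,b}} lies only in M_{a,b}, and any other edge lies
-- exactly in the M_{i,j} whose (i, j) is the midpoint of its two ends.
module Submission where

open import Data.Nat
open import Data.Nat.Properties
open import Data.Nat.DivMod
open import Data.Nat.Tactic.RingSolver using (solve-∀)
open import Data.Fin as Fin using (Fin; toℕ; fromℕ<)
open import Data.Fin.Properties using (toℕ<n; toℕ-injective; toℕ-fromℕ<)
open import Data.Product using (Σ; ∃-syntax; _×_; _,_; proj₁; proj₂)
open import Data.Sum using (_⊎_; inj₁; inj₂)
open import Data.Empty using (⊥-elim)
open import Relation.Binary.PropositionalEquality
open import Relation.Nullary using (¬_; Dec; yes; no)
open import Defs

odd-factor : ∀ c d n → c * d ≡ suc (2 * n) → ∃[ k ] c ≡ suc (2 * k)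
odd-factor c d n cd≡ with c % 2 | m%n<n c 2 | m≡m%n+[m/n]*n c 2
... | 0 | _ | c≡ = ⊥-elim (even≢odd (c / 2 * d) n (begin
  2 * (c / 2 * d) ≡⟨ reassoc (c / 2) d ⟩
  c / 2 * 2 * d   ≡⟨ cong (_* d) c≡ ⟨
  c * d           ≡⟨ cd≡ ⟩
  suc (2 * n)     ∎))
  where
  open ≡-Reasoning
  reassoc : ∀ h d → 2 * (h * d) ≡ h * 2 * d
  reassoc = solve-∀
... | 1 | _ | c≡ = c / 2 , trans c≡ (cong suc (*-comm (c / 2) 2))
... | suc (suc _) | s≤s (s≤s ()) | _

2*[1+n]∸1≡1+2*n : ∀ n → 2 * suc n ∸ 1 ≡ suc (2 * n)
2*[1+n]∸1≡1+2*n n = +-suc n (n + 0)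

module Congruence (y : ℕ) .{{_ : NonZero y}} where

  infix 4 _≈_
  _≈_ : ℕ → ℕ → Set
  a ≈ b = a % y ≡ b % y

  %-≈ : ∀ a → a % y ≈ a
  %-≈ a = m%n%n≡m%n a y

  +-cong : ∀ {a b e f} → a ≈ b → e ≈ f → a + e ≈ b + f
  +-cong {a} {b} {e} {f} a≈b e≈f = begin
    (a + e) % y               ≡⟨ %-distribˡ-+ a e y ⟩
    (a % y + e % y) % y       ≡⟨ cong₂ (λ s t → (s + t) % y) a≈b e≈f ⟩
    (b % y + f % y) % y       ≡⟨ %-distribˡ-+ b f y ⟨
    (b + f) % y               ∎
    where open ≡-Reasoning

  *-congˡ : ∀ k {a b} → a ≈ b → k * a ≈ k * b
  *-congˡ k {a} {b} a≈b = begin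
    (k * a) % y               ≡⟨ %-distribˡ-* k a y ⟩
    (k % y * (a % y)) % y     ≡⟨ cong (λ s → (k % y * s) % y) a≈b ⟩
    (k % y * (b % y)) % y     ≡⟨ %-distribˡ-* k b y ⟨
    (k * b) % y               ∎
    where open ≡-Reasoning

  +-cancelˡ : ∀ a {b e} → a + b ≈ a + e → b ≈ e
  +-cancelˡ a {b} {e} ab≈ae = begin
    b % y                     ≡⟨ [m+n]%n≡m%n b y ⟨
    (b + y) % y               ≡⟨ +-cong {b} refl (sym inverse) ⟩
    (b + (a + a⁻)) % y        ≡⟨ cong (_% y) (rotate b a a⁻) ⟩
    (a⁻ + (a + b)) % y        ≡⟨ +-cong {a⁻} refl ab≈ae ⟩
    (a⁻ + (a + e)) % y        ≡⟨ cong (_% y) (rotate e a a⁻) ⟨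
    (e + (a + a⁻)) % y        ≡⟨ +-cong {e} refl inverse ⟩
    (e + y) % y               ≡⟨ [m+n]%n≡m%n e y ⟩
    e % y                     ∎
    where
    open ≡-Reasoning
    a⁻ : ℕ
    a⁻ = y ∸ a % y
    inverse : a + a⁻ ≈ y
    inverse = begin
      (a + a⁻) % y            ≡⟨ +-cong {a} (sym (%-≈ a)) refl ⟩
      (a % y + a⁻) % y        ≡⟨ cong (_% y) (m+[n∸m]≡n (m%n≤n a y)) ⟩
      y % y                   ∎
    rotate : ∀ p q r → p + (q + r) ≡ r + (q + p)
    rotate = solve-∀

  toℕ-≈-injective : {a b : Fin y} → toℕ a ≈ toℕ b → a ≡ b
  toℕ-≈-injective {a} {b} a≈b =
    toℕ-injective (trans (sym (m<n⇒m%n≡m (toℕ<n a))) (trans a≈b (m<n⇒m%n≡m (toℕ<n b))))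

  toℕ≡%⇒≈ : ∀ (a : Fin y) {e} → toℕ a ≡ e % y → toℕ a ≈ e
  toℕ≡%⇒≈ a {e} a≡ = trans (cong (_% y) a≡) (%-≈ e)

  ≈⇒toℕ≡% : ∀ (a : Fin y) {e} → toℕ a ≈ e → toℕ a ≡ e % y
  ≈⇒toℕ≡% a a≈ = trans (sym (m<n⇒m%n≡m (toℕ<n a))) a≈

  record Midpoint (x a₁ a₂ : Fin y) : Set where
    constructor mkMidpoint
    field sum≈double : toℕ a₁ + toℕ a₂ ≈ 2 * toℕ x

  midpoint-refl : ∀ x → Midpoint x x x
  midpoint-refl x = mkMidpoint (cong (λ s → (toℕ x + s) % y) (sym (+-identityʳ (toℕ x))))

  midpoint-sym : ∀ {x a₁ a₂} → Midpoint x a₁ a₂ → Midpoint x a₂ a₁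
  midpoint-sym {a₁ = a₁} {a₂} (mkMidpoint m) =
    mkMidpoint (trans (cong (_% y) (+-comm (toℕ a₂) (toℕ a₁))) m)

  reflection-unique : ∀ {x a a₂ a₃} → Midpoint x a a₂ → Midpoint x a a₃ → a₂ ≡ a₃
  reflection-unique {a = a} (mkMidpoint m₂) (mkMidpoint m₃) =
    toℕ-≈-injective (+-cancelˡ (toℕ a) (trans m₂ (sym m₃)))

  midpoint-fixed : ∀ {x a} → Midpoint x x a → a ≡ x
  midpoint-fixed {x} m = reflection-unique m (midpoint-refl x)

  reflection-sum : ∀ x l → l ≤ y → (x + l) + (x + (y ∸ l)) ≈ 2 * x
  reflection-sum x l l≤y = begin
    ((x + l) + (x + (y ∸ l))) % y ≡⟨ cong (_% y) (regroup x l (y ∸ l)) ⟩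
    (2 * x + (l + (y ∸ l))) % y   ≡⟨ cong (λ s → (2 * x + s) % y) (m+[n∸m]≡n l≤y) ⟩
    (2 * x + y) % y               ≡⟨ [m+n]%n≡m%n (2 * x) y ⟩
    (2 * x) % y                   ∎
    where
    open ≡-Reasoning
    regroup : ∀ x l r → (x + l) + (x + r) ≡ 2 * x + (l + r)
    regroup = solve-∀

  reflection-partner : ∀ a₁ a₂ x l → l ≤ y → a₁ + a₂ ≈ 2 * x → a₁ ≈ x + l → a₂ ≈ x + (y ∸ l)
  reflection-partner a₁ a₂ x l l≤y sum≈ a₁≈ = +-cancelˡ a₁ {a₂} {x + (y ∸ l)} (begin
    (a₁ + a₂) % y                 ≡⟨ sum≈ ⟩
    (2 * x) % y                   ≡⟨ reflection-sum x l l≤y ⟨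
    ((x + l) + (x + (y ∸ l))) % y ≡⟨ +-cong {x + l} {a₁} {x + (y ∸ l)} (sym a₁≈) refl ⟩
    (a₁ + (x + (y ∸ l))) % y      ∎)
    where open ≡-Reasoning

  infixl 6 _⊖_
  _⊖_ : ℕ → ℕ → ℕ
  a ⊖ x = (a + (y ∸ x)) % y

  ≈+⊖ : ∀ {x} a → x ≤ y → a ≈ x + (a ⊖ x)
  ≈+⊖ {x} a x≤y = sym (begin
    (x + (a ⊖ x)) % y         ≡⟨ +-cong {x} {x} {a ⊖ x} {a + (y ∸ x)} refl (%-≈ (a + (y ∸ x))) ⟩
    (x + (a + (y ∸ x))) % y   ≡⟨ cong (_% y) (+-exchange x a (y ∸ x)) ⟩
    (a + (x + (y ∸ x))) % y   ≡⟨ cong (λ s → (a + s) % y) (m+[n∸m]≡n x≤y) ⟩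
    (a + y) % y               ≡⟨ [m+n]%n≡m%n a y ⟩
    a % y                     ∎)
    where
    open ≡-Reasoning
    +-exchange : ∀ p q r → p + (q + r) ≡ q + (p + r)
    +-exchange = solve-∀

  reflection-midpoint : ∀ {x a₁ a₂} l → l ≤ y →
    toℕ a₁ ≡ (toℕ x + l) % y → toℕ a₂ ≡ (toℕ x + (y ∸ l)) % y → Midpoint x a₁ a₂
  reflection-midpoint {x} {a₁} {a₂} l l≤y a₁≡ a₂≡ = mkMidpoint (
    trans (+-cong (toℕ≡%⇒≈ a₁ a₁≡) (toℕ≡%⇒≈ a₂ a₂≡)) (reflection-sum (toℕ x) l l≤y))

  InP⇒Midpoint : ∀ {x a₁ a₂} → InP y x a₁ a₂ → Midpoint x a₁ a₂
  InP⇒Midpoint (l , l< , inj₁ (a₁≡ , a₂≡)) = reflection-midpoint l (≤-offset l<) a₁≡ a₂≡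
    where
    ≤-offset : ∀ {l} → l < (y + 1) / 2 → l ≤ y
    ≤-offset {l} l< =
      m<1+n⇒m≤n (subst (l <_) (+-comm y 1) (<-≤-trans l< (m/n≤m (y + 1) 2)))
  InP⇒Midpoint (l , l< , inj₂ (a₁≡ , a₂≡)) =
    midpoint-sym (InP⇒Midpoint (l , l< , inj₁ (a₂≡ , a₁≡)))

module OddModulus (k : ℕ) where

  y : ℕ
  y = suc (2 * k)

  open Congruence y public

  half-y : (y + 1) / 2 ≡ suc k
  half-y = trans (cong (_/ 2) (doubled k)) (m*n/n≡m (suc k) 2)
    where
    doubled : ∀ k → suc (2 * k) + 1 ≡ suc k * 2
    doubled = solve-∀

  -- suc k is the inverse of 2 modulo y, because 2 · suc k = y + 1.
  halve : ∀ s → suc k * (2 * s) ≈ s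
  halve s = trans (cong (_% y) (expand s k)) ([m+kn]%n≡m%n s s y)
    where
    expand : ∀ s k → suc k * (2 * s) ≡ s + s * suc (2 * k)
    expand = solve-∀

  *-cancelˡ-2 : ∀ {a b} → 2 * a ≈ 2 * b → a ≈ b
  *-cancelˡ-2 {a} {b} 2a≈2b =
    trans (sym (halve a)) (trans (*-congˡ (suc k) {2 * a} {2 * b} 2a≈2b) (halve b))

  midpoint-unique : ∀ {x x′ a₁ a₂} → Midpoint x a₁ a₂ → Midpoint x′ a₁ a₂ → x ≡ x′
  midpoint-unique {x} {x′} (mkMidpoint m) (mkMidpoint m′) =
    toℕ-≈-injective (*-cancelˡ-2 {toℕ x} {toℕ x′} (trans (sym m) m′))

  midpoint-diag : ∀ {x a} → Midpoint x a a → a ≡ x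
  midpoint-diag {a = a} = midpoint-unique (midpoint-refl a)

  midpoint : (a₁ a₂ : Fin y) → Σ (Fin y) λ x → Midpoint x a₁ a₂
  midpoint a₁ a₂ = fromℕ< x<y , mkMidpoint (sym (begin
    (2 * toℕ (fromℕ< x<y)) % y  ≡⟨ cong (λ t → (2 * t) % y) (toℕ-fromℕ< x<y) ⟩
    (2 * ((suc k * s) % y)) % y ≡⟨ *-congˡ 2 {(suc k * s) % y} {suc k * s} (%-≈ (suc k * s)) ⟩
    (2 * (suc k * s)) % y       ≡⟨ cong (_% y) (*-comm-middle 2 (suc k) s) ⟩
    (suc k * (2 * s)) % y       ≡⟨ halve s ⟩
    s % y                       ∎))
    where
    open ≡-Reasoning
    s : ℕ
    s = toℕ a₁ + toℕ a₂
    x<y : (suc k * s) % y < y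
    x<y = m%n<n (suc k * s) y
    *-comm-middle : ∀ p q r → p * (q * r) ≡ q * (p * r)
    *-comm-middle = solve-∀

  y∸t≤k : ∀ {t} → suc k ≤ t → y ∸ t ≤ k
  y∸t≤k k<t = ≤-trans (∸-monoʳ-≤ y k<t) (≤-reflexive (trans (m+n∸m≡n k (k + 0)) (+-identityʳ k)))

  Midpoint⇒InP : ∀ {x a₁ a₂} → Midpoint x a₁ a₂ → InP y x a₁ a₂
  Midpoint⇒InP {x} {a₁} {a₂} (mkMidpoint m) = by-offset (t <? suc k)
    where
    X t : ℕ
    X = toℕ x
    t = toℕ a₁ ⊖ X
    a₁≈ : toℕ a₁ ≈ X + t
    a₁≈ = ≈+⊖ (toℕ a₁) (<⇒≤ (toℕ<n x))
    t≤y : t ≤ y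
    t≤y = m%n≤n (toℕ a₁ + (y ∸ X)) y
    a₂≈ : toℕ a₂ ≈ X + (y ∸ t)
    a₂≈ = reflection-partner (toℕ a₁) (toℕ a₂) X t t≤y m a₁≈
    -- When t is too large for P_{x,y}, the pair is listed the other way round, with l = y − t.
    by-offset : Dec (t < suc k) → InP y x a₁ a₂
    by-offset (yes t<) = t , subst (t <_) (sym half-y) t<
      , inj₁ (≈⇒toℕ≡% a₁ {X + t} a₁≈ , ≈⇒toℕ≡% a₂ {X + (y ∸ t)} a₂≈)
    by-offset (no t≮) = y ∸ t , subst (y ∸ t <_) (sym half-y) (s≤s (y∸t≤k (≮⇒≥ t≮)))
      , inj₂ (≈⇒toℕ≡% a₁ {X + (y ∸ (y ∸ t))} a₁≈′ , ≈⇒toℕ≡% a₂ {X + (y ∸ t)} a₂≈)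
      where
      a₁≈′ : toℕ a₁ ≈ X + (y ∸ (y ∸ t))
      a₁≈′ = subst (λ s → toℕ a₁ ≈ X + s) (sym (m∸[m∸n]≡n t≤y)) a₁≈

module Decomposition (kc kd : ℕ) where

  module C = OddModulus kc
  module D = OddModulus kd

  c d : ℕ
  c = C.y
  d = D.y

  Midpoint² : Fin c → Fin d → Fin c → Fin d → Fin c → Fin d → Set
  Midpoint² i j a₁ b₁ a₂ b₂ = C.Midpoint i a₁ a₂ × D.Midpoint j b₁ b₂

  v-injective : ∀ {a a′ b b′} → v {c} {d} a b ≡ v a′ b′ → (a , b) ≡ (a′ , b′)
  v-injective refl = refl

  off-centre⇒distinct : ∀ {i j a₁ b₁ a₂ b₂} → Midpoint² i j a₁ b₁ a₂ b₂ →
    a₁ ≢ i ⊎ b₁ ≢ j → v a₁ b₁ ≢ v a₂ b₂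
  off-centre⇒distinct (mc , _) (inj₁ a₁≢i) refl = a₁≢i (C.midpoint-diag mc)
  off-centre⇒distinct (_ , md) (inj₂ b₁≢j) refl = b₁≢j (D.midpoint-diag md)

  distinct⇒off-centre : ∀ {i j a₁ b₁ a₂ b₂} → Midpoint² i j a₁ b₁ a₂ b₂ →
    v a₁ b₁ ≢ v a₂ b₂ → a₁ ≢ i ⊎ b₁ ≢ j
  distinct⇒off-centre {i} {j} {a₁} {b₁} (mc , md) distinct with a₁ Fin.≟ i | b₁ Fin.≟ j
  ... | no a₁≢i | _ = inj₁ a₁≢i
  ... | yes _ | no b₁≢j = inj₂ b₁≢j
  ... | yes refl | yes refl =
    ⊥-elim (distinct (cong₂ v (sym (C.midpoint-fixed mc)) (sym (D.midpoint-fixed md))))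

  MEdge-v∞ˡ : ∀ {i j w} → MEdge c d i j v∞ w → w ≡ v i j
  MEdge-v∞ˡ (inj₁ (_ , w≡)) = w≡
  MEdge-v∞ˡ (inj₂ (inj₁ (() , _)))
  MEdge-v∞ˡ (inj₂ (inj₂ (_ , _ , _ , _ , _ , _ , _ , inj₁ (() , _))))
  MEdge-v∞ˡ (inj₂ (inj₂ (_ , _ , _ , _ , _ , _ , _ , inj₂ (() , _))))

  MEdge-v∞ʳ : ∀ {i j u} → MEdge c d i j u v∞ → u ≡ v i j
  MEdge-v∞ʳ (inj₁ (_ , ()))
  MEdge-v∞ʳ (inj₂ (inj₁ (u≡ , _))) = u≡
  MEdge-v∞ʳ (inj₂ (inj₂ (_ , _ , _ , _ , _ , _ , _ , inj₁ (_ , ()))))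
  MEdge-v∞ʳ (inj₂ (inj₂ (_ , _ , _ , _ , _ , _ , _ , inj₂ (_ , ()))))

  MEdge⇒midpoint : ∀ {i j a₁ b₁ a₂ b₂} → MEdge c d i j (v a₁ b₁) (v a₂ b₂) →
    Midpoint² i j a₁ b₁ a₂ b₂ × v a₁ b₁ ≢ v a₂ b₂
  MEdge⇒midpoint (inj₁ (() , _))
  MEdge⇒midpoint (inj₂ (inj₁ (_ , ())))
  MEdge⇒midpoint {i} {j} (inj₂ (inj₂ (a₁ , a₂ , b₁ , b₂ , pc , pd , off , inj₁ (refl , refl)))) =
    mid , off-centre⇒distinct mid off
    where
    mid : Midpoint² i j a₁ b₁ a₂ b₂
    mid = C.InP⇒Midpoint pc , D.InP⇒Midpoint pd
  MEdge⇒midpoint (inj₂ (inj₂ (_ , _ , _ , _ , pc , pd , off , inj₂ (refl , refl)))) =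
    (C.midpoint-sym mc , D.midpoint-sym md) ,
    λ eq → off-centre⇒distinct (mc , md) off (sym eq)
    where
    mc = C.InP⇒Midpoint pc
    md = D.InP⇒Midpoint pd

  midpoint⇒MEdge : ∀ {i j a₁ b₁ a₂ b₂} → Midpoint² i j a₁ b₁ a₂ b₂ →
    v a₁ b₁ ≢ v a₂ b₂ → MEdge c d i j (v a₁ b₁) (v a₂ b₂)
  midpoint⇒MEdge (mc , md) distinct = inj₂ (inj₂
    ( _ , _ , _ , _ , C.Midpoint⇒InP mc , D.Midpoint⇒InP md
    , distinct⇒off-centre (mc , md) distinct , inj₁ (refl , refl)))

  centre-partner : ∀ {i j w} → MEdge c d i j (v i j) w → w ≡ v∞
  centre-partner {w = v∞} _ = refl
  centre-partner {w = v _ _} e with MEdge⇒midpoint e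
  ... | (mc , md) , distinct =
    ⊥-elim (distinct (cong₂ v (sym (C.midpoint-fixed mc)) (sym (D.midpoint-fixed md))))

  MEdge-irreflexive : ∀ i j u → ¬ MEdge c d i j u u
  MEdge-irreflexive i j v∞ e with MEdge-v∞ˡ e
  ... | ()
  MEdge-irreflexive i j (v a b) e = proj₂ (MEdge⇒midpoint e) refl

  MEdge-functional : ∀ i j u w w′ → MEdge c d i j u w → MEdge c d i j u w′ → w ≡ w′
  MEdge-functional i j v∞ w w′ e e′ = trans (MEdge-v∞ˡ e) (sym (MEdge-v∞ˡ e′))
  MEdge-functional i j (v a b) v∞ v∞ e e′ = refl
  MEdge-functional i j (v a b) v∞ w′ e e′ with MEdge-v∞ʳ e
  ... | refl = sym (centre-partner e′)
  MEdge-functional i j (v a b) w v∞ e e′ with MEdge-v∞ʳ e′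
  ... | refl = centre-partner e
  MEdge-functional i j (v a b) (v a₂ b₂) (v a₃ b₃) e e′
    with MEdge⇒midpoint e | MEdge⇒midpoint e′
  ... | (mc , md) , _ | (mc′ , md′) , _ =
    cong₂ v (C.reflection-unique mc mc′) (D.reflection-unique md md′)

  unique-MEdge : (u w : Vertex c d) → u ≢ w →
    Σ (Fin c × Fin d) λ p →
      MEdge c d (proj₁ p) (proj₂ p) u w
      × ((q : Fin c × Fin d) → MEdge c d (proj₁ q) (proj₂ q) u w → q ≡ p)
  unique-MEdge v∞ v∞ distinct = ⊥-elim (distinct refl)
  unique-MEdge v∞ (v a b) _ =
    (a , b) , inj₁ (refl , refl) , λ q e → sym (v-injective (MEdge-v∞ˡ e))
  unique-MEdge (v a b) v∞ _ =
    (a , b) , inj₂ (inj₁ (refl , refl)) , λ q e → sym (v-injective (MEdge-v∞ʳ e))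
  unique-MEdge (v a₁ b₁) (v a₂ b₂) distinct =
    (i , j) , midpoint⇒MEdge (mc , md) distinct , λ q e → at-midpoint q (proj₁ (MEdge⇒midpoint e))
    where
    i = proj₁ (C.midpoint a₁ a₂)
    j = proj₁ (D.midpoint b₁ b₂)
    mc = proj₂ (C.midpoint a₁ a₂)
    md = proj₂ (D.midpoint b₁ b₂)
    at-midpoint : ∀ q → Midpoint² (proj₁ q) (proj₂ q) a₁ b₁ a₂ b₂ → q ≡ (i , j)
    at-midpoint (q₁ , q₂) (mc′ , md′) =
      cong₂ _,_ (C.midpoint-unique mc′ mc) (D.midpoint-unique md′ md)

lemma18 : (m c d : ℕ) → 1 ≤ m → c * d ≡ 2 * m ∸ 1 →
    .{{_ : NonZero c}} → .{{_ : NonZero d}} →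
    ((i : Fin c) (j : Fin d) → IsMatching (MEdge c d i j))
    × ((u w : Vertex c d) → u ≢ w →
        Σ (Fin c × Fin d) λ p →
          MEdge c d (proj₁ p) (proj₂ p) u w
          × ((q : Fin c × Fin d) →
              MEdge c d (proj₁ q) (proj₂ q) u w → q ≡ p))
lemma18 (suc n) c d _ cd≡
  with odd-factor c d n (trans cd≡ (2*[1+n]∸1≡1+2*n n))
     | odd-factor d c n (trans (*-comm d c) (trans cd≡ (2*[1+n]∸1≡1+2*n n)))
... | kc , refl | kd , refl =
  (λ i j → MEdge-irreflexive i j , MEdge-functional i j) , unique-MEdge
  where open Decomposition kc kd
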